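{- Let $G=(V,A)$ be an $n$-vertex permutation DAG, $\gamma$ an umbrella-free topological ordering of $G$, let $v_1,\ldots,v_n$ be the vertices chosen (in order) and $\sigma(v)$ the value assigned to vertex $v$ by $\mathtt{GreedyAssign}(G,\gamma)$. Let $\sigma^*$ be a sequence achieving $\alpha(G,\gamma)$, viewed as an assignment $\sigma^*(v):=\sigma^*_{\gamma(v)}$ of values to vertices. Then $\sigma(v_i)\le\sigma^*(v_i)$ for all $i\in[n]$.
   Context: $\mathsf{PermDAG}(\sigma)$ has vertices $t_1,\ldots,t_n$ and an arc $(t_j,t_i)$ for every $i<j$ with $\sigma(i)\le\sigma(j)$; a permutation DAG is a directed graph isomorphic to some $\mathsf{PermDAG}(\tau)$. A topological ordering of an $n$-vertex DAG $G=(V,A)$ is a bijection $\gamma:V\to[n]$ with $\gamma(u)<\gamma(v)$ for every arc $(v,u)\in A$; it is umbrella-free if for every $(v,u)\in A$ and every $w$ with $\gamma(u)<\gamma(w)<\gamma(v)$, $(w,u)\in A$ or $(v,w)\in A$. $\alpha(G,\gamma)$ is the minimum $k$ such that some $\tau\in[k]^n$ has $\mathsf{PermDAG}(\tau)$ isomorphic to $G$ under $\phi(t_i)=\gamma^{ -1}(i)$; a sequence achieving it is such a $\tau$ with $k=\alpha(G,\gamma)$. Given a DAG $H$ with vertex ordering $\gamma_H$, a vertex $u$ is fully suffix connected if $(v,u)$ is an arc for every $v$ with $\gamma_H(v)>\gamma_H(u)$; the $\gamma_H$-LFSC vertex is the fully suffix connected vertex with smallest $\gamma_H$-value. Algorithm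 $\mathtt{GreedyAssign}(G,\gamma)$: set $\alpha\leftarrow1$, $G_1\leftarrow G$, $\gamma_1\leftarrow\gamma$, $\gamma(v_0)\leftarrow-\infty$. For $i=1,\ldots,n$: let $v_i$ be the $\gamma_i$-LFSC vertex of $G_i$; if $\gamma(v_i)<\gamma(v_{i-1})$ then $\alpha\leftarrow\alpha+1$; set $G_{i+1}\leftarrow G_i-v_i$, let $\gamma_{i+1}$ be the ordering of $V(G_{i+1})$ inheriting the relative order of $\gamma_i$; set $\sigma(v_i)\leftarrow\alpha$. -}

module Defs where

open import Data.Nat using (ℕ; zero; suc; _≤_; _<_)
open import Data.Nat.Properties using (_<?_)
open import Data.Fin using (Fin; toℕ) renaming (_<_ to _<ᶠ_)
open import Data.Fin.Properties using (_≟_)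
open import Data.Bool using (Bool; true; false; if_then_else_; not)
open import Data.List using (List; []; _∷_; map; filter)
open import Data.Maybe using (Maybe; just; nothing)
open import Data.Product using (_×_; _,_; Σ; ∃)
open import Data.Sum using (_⊎_)
open import Function.Bundles using (_↔_; Inverse; _⇔_)
open import Relation.Binary.PropositionalEquality using (_≡_)
open import Relation.Nullary using (does; ¬_)
open import Data.List.Base using (allFin)

Adj : ℕ → Set
Adj n = Fin n → Fin n → Bool

Arc : ∀ {n} → Adj n → Fin n → Fin n → Set
Arc adj v u = adj v u ≡ true

-- PermDAG(τ) for a sequence τ (positions 0..n-1 instead of 1..n):
-- arc (t_j , t_i) iff i < j and τ i ≤ τ j.
PermArc : ∀ {n} → (Fin n → ℕ) → Fin n → Fin n → Set
PermArc τ j i = (i <ᶠ j) × (τ i ≤ τ j)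

-- G is isomorphic to PermDAG(τ) via the bijection φ : t_i ↦ φ i.
IsoVia : ∀ {n} → Adj n → (Fin n → ℕ) → (Fin n → Fin n) → Set
IsoVia adj τ φ = ∀ i j → PermArc τ j i ⇔ Arc adj (φ j) (φ i)

IsPermDAG : ∀ {n} → Adj n → Set
IsPermDAG {n} adj =
  Σ (Fin n ↔ Fin n) λ τ → Σ (Fin n ↔ Fin n) λ φ →
    IsoVia adj (λ i → toℕ (Inverse.to τ i)) (Inverse.to φ)

IsTopOrder : ∀ {n} → Adj n → (Fin n ↔ Fin n) → Set
IsTopOrder adj γ = ∀ v u → Arc adj v u → Inverse.to γ u <ᶠ Inverse.to γ v

UmbrellaFree : ∀ {n} → Adj n → (Fin n ↔ Fin n) → Set
UmbrellaFree adj γ = ∀ v u w → Arc adj v u →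
  Inverse.to γ u <ᶠ Inverse.to γ w → Inverse.to γ w <ᶠ Inverse.to γ v →
  Arc adj w u ⊎ Arc adj v w

InRange : ∀ {n} → ℕ → (Fin n → ℕ) → Set
InRange k τ = ∀ i → (1 ≤ τ i) × (τ i ≤ k)

-- τ realizes (G, γ): PermDAG(τ) ≅ G under φ(t_i) = γ⁻¹(i)
Realizes : ∀ {n} → Adj n → (Fin n ↔ Fin n) → (Fin n → ℕ) → Set
Realizes adj γ τ = IsoVia adj τ (Inverse.from γ)

Achieves : ∀ {n} → Adj n → (Fin n ↔ Fin n) → (Fin n → ℕ) → Set
Achieves {n} adj γ σ* =
  Σ ℕ λ k → InRange k σ* × Realizes adj γ σ* ×
    (∀ k′ (τ : Fin n → ℕ) → InRange k′ τ → Realizes adj γ τ → k ≤ k′)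

-- GreedyAssign.  The current graph G_i is represented by the list of its
-- vertices in γ_i-order (inherited order of γ).

allB : ∀ {A : Set} → (A → Bool) → List A → Bool
allB p [] = true
allB p (x ∷ xs) = if p x then allB p xs else false

-- the LFSC vertex: first vertex u of the list such that every later vertex
-- v has an arc (v , u)
lfsc : ∀ {n} → Adj n → List (Fin n) → Maybe (Fin n)
lfsc adj [] = nothing
lfsc adj (u ∷ rest) = if allB (λ v → adj v u) rest then just u else lfsc adj rest

removeV : ∀ {n} → Fin n → List (Fin n) → List (Fin n)
removeV u = filter (λ x → Relation.Nullary.¬? (u ≟ x))

-- fuel, current vertex list, previously chosen vertex (nothing = v₀ with
-- γ(v₀) = -∞), current α; returns the chosen vertices v₁,v₂,… paired with σ(vᵢ)
greedy : ∀ {n} → Adj n → (Fin n ↔ Fin n) → ℕ → List (Fin n) → Maybe (Fin n) → ℕ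
       → List (Fin n × ℕ)
greedy adj γ zero L prev α = []
greedy adj γ (suc fuel) L prev α with lfsc adj L
... | nothing = []
... | just v =
  let α′ = bump prev in (v , α′) ∷ greedy adj γ fuel (removeV v L) (just v) α′
  where
  bump : Maybe _ → ℕ
  bump nothing = α
  bump (just p) = if does (toℕ (Inverse.to γ v) <? toℕ (Inverse.to γ p)) then suc α else α

GreedyAssign : ∀ {n} → Adj n → (Fin n ↔ Fin n) → List (Fin n × ℕ)
GreedyAssign {n} adj γ = greedy adj γ n (map (Inverse.from γ) (allFin n)) nothing 1

-- Let val v := σ*(γ v) and pos v := γ v.  Since σ* realizes (G, γ), a vertex
-- u has an arc from every γ-later vertex v exactly when val u ≤ val v for
-- all of them.  Hence the LFSC vertex of the remaining graph is the least
-- remaining vertex in the lexicographic order on (val, pos), so GreedyAssign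
-- visits the vertices in that order.  The counter only increases when pos
-- decreases between consecutive choices, which in this order forces val to
-- increase strictly; so the counter never overtakes val, which starts ≥ 1.
module Submission where

open import Defs
open import Data.Bool using (Bool; true; false; if_then_else_)
open import Data.Empty using (⊥-elim)
open import Data.Fin using (Fin; toℕ) renaming (_≟_ to _≟ᶠ_)
open import Data.List using (List; []; _∷_; map; allFin)
open import Data.List.Membership.Propositional using (_∈_; find)
open import Data.List.Membership.Propositional.Properties using (∈-filter⁻)
open import Data.List.Relation.Unary.All using (All; []; _∷_)
import Data.List.Relation.Unary.All as All
open import Data.List.Relation.Unary.AllPairs using (AllPairs; []; _∷_)
import Data.List.Relation.Unary.AllPairs.Properties as AllPairs
open import Data.List.Relation.Unary.Any using (Any; here; there)
open import Data.Maybe using (Maybe; just; nothing)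
open import Data.Nat using (ℕ; suc; _≤_; _<_; _≤?_; s≤s)
open import Data.Nat.Properties
  using (≤-refl; ≤-trans; <⇒≤; ≤-<-trans; <-asym; ≰⇒>; _<?_; m≤n⇒m<n∨m≡n)
open import Data.Product using (_×_; _,_; proj₁; proj₂; Σ)
open import Data.Sum using (_⊎_; inj₁; inj₂; [_,_])
open import Function.Bundles using (_↔_; _⇔_; Inverse; Equivalence)
open import Relation.Binary.PropositionalEquality
  using (_≡_; _≢_; refl; sym; trans; subst; subst₂; cong)
open import Relation.Nullary using (Dec; yes; no; does)

module _ {A : Set} (p : A → Bool) where

  allB-true⇒All : ∀ xs → allB p xs ≡ true → All (λ x → p x ≡ true) xs
  allB-true⇒All []       _ = []
  allB-true⇒All (x ∷ xs) e with p x in px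
  ... | true  = px ∷ allB-true⇒All xs e

  allB-false⇒Any : ∀ xs → allB p xs ≡ false → Any (λ x → p x ≡ false) xs
  allB-false⇒Any (x ∷ xs) e with p x in px
  ... | true  = there (allB-false⇒Any xs e)
  ... | false = here px

module Greedy {n} (adj : Adj n) (γ : Fin n ↔ Fin n) (σ* : Fin n → ℕ)
              (realizes : Realizes adj γ σ*) (positive : ∀ i → 1 ≤ σ* i) where
  open Inverse γ

  val pos : Fin n → ℕ
  val v = σ* (to v)
  pos v = toℕ (to v)

  Sorted : List (Fin n) → Set
  Sorted = AllPairs (λ u v → pos u < pos v)

  infix 4 _⊏_
  _⊏_ : Fin n → Fin n → Set
  u ⊏ v = val u < val v ⊎ (val u ≡ val v × pos u < pos v)

  ⊏⇒val≤ : ∀ {u v} → u ⊏ v → val u ≤ val v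
  ⊏⇒val≤ (inj₁ lt)       = <⇒≤ lt
  ⊏⇒val≤ (inj₂ (eq , _)) = subst (val _ ≤_) eq ≤-refl

  val≤∧pos<⇒⊏ : ∀ {u v} → val u ≤ val v → pos u < pos v → u ⊏ v
  val≤∧pos<⇒⊏ le pu<pv with m≤n⇒m<n∨m≡n le
  ... | inj₁ lt = inj₁ lt
  ... | inj₂ eq = inj₂ (eq , pu<pv)

  IsLeast : Fin n → List (Fin n) → Set
  IsLeast v L = ∀ x → x ∈ L → x ≢ v → v ⊏ x

  realized⇔arc : ∀ u v → (pos u < pos v × val u ≤ val v) ⇔ Arc adj v u
  realized⇔arc u v =
    subst₂ (λ a b → (pos u < pos v × val u ≤ val v) ⇔ Arc adj b a)
           (strictlyInverseʳ u) (strictlyInverseʳ v) (realizes (to u) (to v))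

  noArc⇒val> : ∀ u v → pos u < pos v → adj v u ≡ false → val v < val u
  noArc⇒val> u v pu<pv noArc with val u ≤? val v
  ... | no  u≰v = ≰⇒> u≰v
  ... | yes u≤v with trans (sym noArc) (Equivalence.to (realized⇔arc u v) (pu<pv , u≤v))
  ...   | ()

  -- A rejected head u lacks an arc from some later w, so val w < val u.
  lfsc-isLeast : ∀ L → Sorted L → ∀ v → lfsc adj L ≡ just v → v ∈ L × IsLeast v L
  lfsc-isLeast (u ∷ rest) (u<rest ∷ sorted) v e
    with allB (λ w → adj w u) rest in suffixConnected
  lfsc-isLeast (u ∷ rest) (u<rest ∷ sorted) v refl | true =
    here refl , λ where
      x (here refl) x≢u → ⊥-elim (x≢u refl)
      x (there x∈rest) _ →
        val≤∧pos<⇒⊏ (proj₂ (Equivalence.from (realized⇔arc u x) (All.lookup arcs x∈rest)))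
                    (All.lookup u<rest x∈rest)
    where
    arcs : All (λ x → Arc adj x u) rest
    arcs = allB-true⇒All (λ w → adj w u) rest suffixConnected
  ... | false with lfsc-isLeast rest sorted v e
  ...   | v∈rest , least = there v∈rest , λ where
      x (here refl) _ → inj₁ (≤-<-trans v≤w (noArc⇒val> x w (All.lookup u<rest w∈rest) noArc))
      x (there x∈rest) x≢v → least x x∈rest x≢v
    where
    witness : Σ (Fin n) λ w → w ∈ rest × adj w u ≡ false
    witness = find (allB-false⇒Any (λ w → adj w u) rest suffixConnected)
    w : Fin n
    w = proj₁ witness
    w∈rest : w ∈ rest
    w∈rest = proj₁ (proj₂ witness)
    noArc : adj w u ≡ false
    noArc = proj₂ (proj₂ witness)
    v≤w : val v ≤ val w
    v≤w with w ≟ᶠ v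
    ... | yes refl = ≤-refl
    ... | no  w≢v  = ⊏⇒val≤ (least w w∈rest w≢v)

  Invariant : Maybe (Fin n) → ℕ → List (Fin n) → Set
  Invariant nothing  α L = α ≤ 1
  Invariant (just q) α L = α ≤ val q × (∀ x → x ∈ L → q ⊏ x)

  counter≤val : ∀ {q v α} → α ≤ val q → q ⊏ v →
                (if does (pos v <? pos q) then suc α else α) ≤ val v
  counter≤val {q} {v} {α} α≤q q⊏v = bumped (pos v <? pos q)
    where
    bumped : (d : Dec (pos v < pos q)) → (if does d then suc α else α) ≤ val v
    bumped (yes v<q) = [ ≤-trans (s≤s α≤q) , (λ (_ , q<v) → ⊥-elim (<-asym v<q q<v)) ] q⊏v
    bumped (no _)    = ≤-trans α≤q (⊏⇒val≤ q⊏v)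

  invariant-removeV : ∀ {v α L} → α ≤ val v → IsLeast v L →
                      Invariant (just v) α (removeV v L)
  invariant-removeV {L = L} α≤v least = α≤v , λ x x∈L′ →
    let x∈L , v≢x = ∈-filter⁻ _ {xs = L} x∈L′ in least x x∈L (λ x≡v → v≢x (sym x≡v))

  greedy-≤ : ∀ fuel L prev α → Sorted L → Invariant prev α L →
             All (λ (v , c) → c ≤ val v) (greedy adj γ fuel L prev α)
  greedy-≤ 0 L prev α sorted inv = []
  greedy-≤ (suc fuel) L prev α sorted inv with lfsc adj L in chosen
  ... | nothing = []
  greedy-≤ (suc fuel) L nothing α sorted α≤1 | just v =
    α≤v ∷ greedy-≤ fuel _ (just v) α (AllPairs.filter⁺ _ sorted) (invariant-removeV α≤v least)
    where
    least : IsLeast v L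
    least = proj₂ (lfsc-isLeast L sorted v chosen)
    α≤v : α ≤ val v
    α≤v = ≤-trans α≤1 (positive (to v))
  greedy-≤ (suc fuel) L (just q) α sorted (α≤q , q⊏L) | just v =
    c≤v ∷ greedy-≤ fuel _ (just v) _ (AllPairs.filter⁺ _ sorted) (invariant-removeV c≤v least)
    where
    v∈L×least : v ∈ L × IsLeast v L
    v∈L×least = lfsc-isLeast L sorted v chosen
    least : IsLeast v L
    least = proj₂ v∈L×least
    c≤v : (if does (pos v <? pos q) then suc α else α) ≤ val v
    c≤v = counter≤val α≤q (q⊏L v (proj₁ v∈L×least))

  sorted-initial : Sorted (map from (allFin n))
  sorted-initial = AllPairs.map⁺ (AllPairs.tabulate⁺-< λ {i} {j} i<j →
    subst₂ _<_ (sym (cong toℕ (strictlyInverseˡ i))) (sym (cong toℕ (strictlyInverseˡ j))) i<j)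

lemma5 : ∀ n (adj : Adj n) (γ : Fin n ↔ Fin n) (σ* : Fin n → ℕ) →
    IsPermDAG adj → IsTopOrder adj γ → UmbrellaFree adj γ →
    Achieves adj γ σ* →
    All (λ p → proj₂ p ≤ σ* (Inverse.to γ (proj₁ p))) (GreedyAssign adj γ)
lemma5 n adj γ σ* _ _ _ (_ , inRange , realizes , _) =
  greedy-≤ n _ nothing 1 sorted-initial ≤-refl
  where open Greedy adj γ σ* realizes (λ i → proj₁ (inRange i))
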